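{- For every Bayesian proposition $\lfloor\Gamma\rfloor$: if $\vdash\lfloor\Gamma\rfloor$ then $\vDash\lfloor\Gamma\rfloor$.
   Context: Language: $\mathcal{P}$ is a set of atomic propositions; the set $\mathcal{C}$ of conditional propositions is the smallest set containing $\bot$ and $\mathcal{P}$ and closed under $X\to Y$ and $[X]Y$. Abbreviations: $\neg X:=X\to\bot$, $X\vee Y:=\neg X\to Y$, $X\wedge Y:=\neg(\neg X\vee\neg Y)$, $\top:=\neg\bot$, $X\leftrightarrow Y:=(X\to Y)\wedge(Y\to X)$. A Bayesian proposition is a formal expression $\lfloor X_1|\cdots|X_n\rfloor$ with $n\ge1$, $X_i\in\mathcal{C}$; $\Gamma,\Delta$ denote finite (possibly empty) sequences $X_1|\cdots|X_k$ and $\lfloor\Gamma|X\rfloor$ denotes appending. Semantics: a Bayesian algebra is a Boolean algebra $(E,\cap,\cup,\sim,\bot,\top)$ with $[\;]:E\times E\to E$ such that for all $x,y$: $z\mapsto[x]z$ is a Boolean automorphism; $x\subset y$ implies $[x]y=\top$ or $x=\bot$; $x\cap[x]y=x\cap y$; $[x][x]y=[\sim x][x]y=[x]y$. A valuation in $E$ is a map $H:\mathcal{C}\to E$ with $H(\bot)=\bot$, $H(X\to Y)=\sim H(X)\cup H(Y)$, $H([X]Y)=[H(X)]H(Y)$. $H\vDash\lfloor X_1|\cdots|X_n\rfloor$ iff $H(X_i)=\top$ for some $i$; $\vDash\lfloor\Gamma\rfloor$ iff $H\vDash\lfloor\Gamma\rfloor$ for every valuation $H$ in every Bayesian algebra.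 Proof system: axioms are $\lfloor A\rfloor$ for every instance $A$ (metavariables ranging over $\mathcal{C}$) of the axiom schemas of a standard Hilbert system for classical propositional logic in $\bot,\to$; $\lfloor[X](Y\to Z)\to([X]Y\to[X]Z)\rfloor$; $\lfloor[X]Y\to(X\to Y)\rfloor$; $\lfloor[X]\neg Y\leftrightarrow\neg[X]Y\rfloor$. Rules: from $\lfloor\Gamma|X\rfloor$ and $\lfloor\Delta|X\to Y\rfloor$ infer $\lfloor\Gamma|\Delta|Y\rfloor$; permute the components; from $\lfloor\Gamma|X|X\rfloor$ infer $\lfloor\Gamma|X\rfloor$; from $\lfloor\Gamma\rfloor$ infer $\lfloor\Gamma|X\rfloor$; from $\lfloor\Gamma|X\to Y\rfloor$ infer $\lfloor\Gamma|\neg X|[X]Y\rfloor$; from $\lfloor\Gamma|Y\leftrightarrow\neg X\rfloor$ and $\lfloor\Gamma|[X]Z\leftrightarrow Z\rfloor$ infer $\lfloor\Gamma|[Y]Z\leftrightarrow Z\rfloor$. $\vdash\lfloor\Gamma\rfloor$ means derivable. -}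

module Defs where

open import Level using (Level; _⊔_) renaming (suc to lsuc)
open import Data.List using (List; []; _∷_; _++_; [_])
open import Data.List.Relation.Unary.Any using (Any)
open import Data.List.Relation.Binary.Permutation.Propositional using (_↭_)
open import Data.Product using (Σ; _×_)
open import Data.Sum using (_⊎_)
open import Algebra.Lattice.Bundles using (BooleanAlgebra)

module Syntax {p} (P : Set p) where

  infixr 5 _⇒_
  infixr 6 ⟦_⟧_

  data Cond : Set p where
    bot  : Cond
    atom : P → Cond
    _⇒_  : Cond → Cond → Cond
    ⟦_⟧_ : Cond → Cond → Cond

  ¬c : Cond → Cond
  ¬c X = X ⇒ bot

  top : Cond
  top = ¬c bot

  _∨c_ : Cond → Cond → Cond
  X ∨c Y = ¬c X ⇒ Y

  _∧c_ : Cond → Cond → Cond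
  X ∧c Y = ¬c (¬c X ∨c ¬c Y)

  _⇔c_ : Cond → Cond → Cond
  X ⇔c Y = (X ⇒ Y) ∧c (Y ⇒ X)

  -- Bayesian propositions ⌊X₁|⋯|Xₙ⌋ are represented by the list of
  -- their components; appending ⌊Γ|X⌋ is  Γ ++ [ X ].

  data ⊢_ : List Cond → Set p where
    axK   : ∀ X Y → ⊢ [ X ⇒ (Y ⇒ X) ]
    axS   : ∀ X Y Z → ⊢ [ (X ⇒ (Y ⇒ Z)) ⇒ ((X ⇒ Y) ⇒ (X ⇒ Z)) ]
    axDNE : ∀ X → ⊢ [ ¬c (¬c X) ⇒ X ]
    axDist : ∀ X Y Z → ⊢ [ ⟦ X ⟧ (Y ⇒ Z) ⇒ (⟦ X ⟧ Y ⇒ ⟦ X ⟧ Z) ]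
    axMP   : ∀ X Y → ⊢ [ ⟦ X ⟧ Y ⇒ (X ⇒ Y) ]
    axNeg  : ∀ X Y → ⊢ [ (⟦ X ⟧ (¬c Y)) ⇔c (¬c (⟦ X ⟧ Y)) ]
    mp    : ∀ Γ Δ X Y → ⊢ (Γ ++ [ X ]) → ⊢ (Δ ++ [ X ⇒ Y ]) → ⊢ (Γ ++ Δ ++ [ Y ])
    perm  : ∀ Γ Δ → Γ ↭ Δ → ⊢ Γ → ⊢ Δ
    contr : ∀ Γ X → ⊢ (Γ ++ X ∷ X ∷ []) → ⊢ (Γ ++ [ X ])
    weak  : ∀ Γ X → ⊢ Γ → ⊢ (Γ ++ [ X ])
    cond  : ∀ Γ X Y → ⊢ (Γ ++ [ X ⇒ Y ]) → ⊢ (Γ ++ ¬c X ∷ ⟦ X ⟧ Y ∷ [])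
    indep : ∀ Γ X Y Z → ⊢ (Γ ++ [ Y ⇔c ¬c X ]) → ⊢ (Γ ++ [ (⟦ X ⟧ Z) ⇔c Z ])
          → ⊢ (Γ ++ [ (⟦ Y ⟧ Z) ⇔c Z ])

record IsBayesian {c ℓ} (B : BooleanAlgebra c ℓ)
                  (cnd : BooleanAlgebra.Carrier B → BooleanAlgebra.Carrier B → BooleanAlgebra.Carrier B)
                  : Set (c ⊔ ℓ) where
  open BooleanAlgebra B
  field
    cnd-cong : ∀ {x x' y y'} → x ≈ x' → y ≈ y' → cnd x y ≈ cnd x' y'
    hom-∧ : ∀ x y z → cnd x (y ∧ z) ≈ (cnd x y ∧ cnd x z)
    hom-∨ : ∀ x y z → cnd x (y ∨ z) ≈ (cnd x y ∨ cnd x z)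
    hom-¬ : ∀ x y → cnd x (¬ y) ≈ ¬ (cnd x y)
    hom-⊤ : ∀ x → cnd x ⊤ ≈ ⊤
    hom-⊥ : ∀ x → cnd x ⊥ ≈ ⊥
    injective  : ∀ x y z → cnd x y ≈ cnd x z → y ≈ z
    surjective : ∀ x w → Σ Carrier (λ z → cnd x z ≈ w)
    subset : ∀ x y → (x ∧ y) ≈ x → (cnd x y ≈ ⊤) ⊎ (x ≈ ⊥)
    meet : ∀ x y → (x ∧ cnd x y) ≈ (x ∧ y)
    idem    : ∀ x y → cnd x (cnd x y) ≈ cnd x y
    idem-¬  : ∀ x y → cnd (¬ x) (cnd x y) ≈ cnd x y

record BayesianAlgebra c ℓ : Set (lsuc (c ⊔ ℓ)) where
  field
    boolean    : BooleanAlgebra c ℓ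
    cnd        : BooleanAlgebra.Carrier boolean → BooleanAlgebra.Carrier boolean
               → BooleanAlgebra.Carrier boolean
    isBayesian : IsBayesian boolean cnd
  open BooleanAlgebra boolean public
  open IsBayesian isBayesian public

module Semantics {p} (P : Set p) {c ℓ} (E : BayesianAlgebra c ℓ) where
  open Syntax P
  open BayesianAlgebra E

  record Valuation : Set (p ⊔ c ⊔ ℓ) where
    field
      H     : Cond → Carrier
      H-bot : H bot ≈ ⊥
      H-imp : ∀ X Y → H (X ⇒ Y) ≈ (¬ H X ∨ H Y)
      H-cnd : ∀ X Y → H (⟦ X ⟧ Y) ≈ cnd (H X) (H Y)

  _⊨_ : Valuation → List Cond → Set (ℓ ⊔ p)
  V ⊨ Γ = Any (λ X → Valuation.H V X ≈ ⊤) Γ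

  ValidIn : List Cond → Set (p ⊔ c ⊔ ℓ)
  ValidIn Γ = (V : Valuation) → V ⊨ Γ

module Submission where

open import Defs
open import Function using (_∘_)
open import Data.List using (List; []; _∷_; _++_; [_])
open import Data.List.Relation.Unary.Any using (Any; here; there)
open import Data.List.Relation.Unary.Any.Properties
  using (++⁺ˡ; ++⁺ʳ; ++⁻; singleton⁻)
open import Data.List.Relation.Binary.Permutation.Propositional.Properties
  using (Any-resp-↭)
open import Data.Sum using (_⊎_; inj₁; inj₂; [_,_]′)
import Data.Sum as Sum
open import Algebra.Lattice.Bundles using (BooleanAlgebra)
import Algebra.Lattice.Properties.BooleanAlgebra as BooleanAlgebraProperties
import Relation.Binary.Reasoning.Setoid as SetoidReasoning

module BooleanImplication {c ℓ} (B : BooleanAlgebra c ℓ) where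
  open BooleanAlgebra B
  open BooleanAlgebraProperties B
  open SetoidReasoning setoid

  infixr 5 _⇒ᴮ_

  _⇒ᴮ_ : Carrier → Carrier → Carrier
  a ⇒ᴮ b = ¬ a ∨ b

  ⇒ᴮ-congˡ : ∀ {a a' b} → a ≈ a' → (a ⇒ᴮ b) ≈ (a' ⇒ᴮ b)
  ⇒ᴮ-congˡ e = ∨-congʳ (¬-cong e)

  -- An implication is valid exactly when its antecedent lies below its
  -- consequent; these two directions replace all truth-table reasoning.
  ≤⇒⇒ᴮ-⊤ : ∀ {a b} → (a ∧ b) ≈ a → (a ⇒ᴮ b) ≈ ⊤
  ≤⇒⇒ᴮ-⊤ {a} {b} a≤b = begin
    ¬ a ∨ b               ≈⟨ ∨-congʳ (¬-cong a≤b) ⟨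
    ¬ (a ∧ b) ∨ b         ≈⟨ ∨-congʳ (deMorgan₁ a b) ⟩
    (¬ a ∨ ¬ b) ∨ b       ≈⟨ ∨-assoc (¬ a) (¬ b) b ⟩
    ¬ a ∨ (¬ b ∨ b)       ≈⟨ ∨-congˡ (∨-complementˡ b) ⟩
    ¬ a ∨ ⊤               ≈⟨ ∨-zeroʳ (¬ a) ⟩
    ⊤                     ∎

  ⇒ᴮ-⊤⇒≤ : ∀ {a b} → (a ⇒ᴮ b) ≈ ⊤ → (a ∧ b) ≈ a
  ⇒ᴮ-⊤⇒≤ {a} {b} valid = begin
    a ∧ b                 ≈⟨ ∨-identityʳ (a ∧ b) ⟨
    (a ∧ b) ∨ ⊥           ≈⟨ ∨-congˡ (∧-complementʳ a) ⟨
    (a ∧ b) ∨ (a ∧ ¬ a)   ≈⟨ ∧-distribˡ-∨ a b (¬ a) ⟨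
    a ∧ (b ∨ ¬ a)         ≈⟨ ∧-congˡ (trans (∨-comm b (¬ a)) valid) ⟩
    a ∧ ⊤                 ≈⟨ ∧-identityʳ a ⟩
    a                     ∎

  ⇒ᴮ-refl : ∀ {a b} → a ≈ b → (a ⇒ᴮ b) ≈ ⊤
  ⇒ᴮ-refl {a} e = ≤⇒⇒ᴮ-⊤ (trans (∧-congˡ (sym e)) (∧-idem a))

  ⇒ᴮ-mp : ∀ {a b} → a ≈ ⊤ → (a ⇒ᴮ b) ≈ ⊤ → b ≈ ⊤
  ⇒ᴮ-mp {a} {b} a≈⊤ valid = begin
    b                     ≈⟨ ∧-identityˡ b ⟨
    ⊤ ∧ b                 ≈⟨ ∧-congʳ a≈⊤ ⟨
    a ∧ b                 ≈⟨ ⇒ᴮ-⊤⇒≤ valid ⟩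
    a                     ≈⟨ a≈⊤ ⟩
    ⊤                     ∎

  ∧-⊤ˡ : ∀ {a b} → (a ∧ b) ≈ ⊤ → a ≈ ⊤
  ∧-⊤ˡ {a} {b} e = begin
    a                     ≈⟨ ∨-absorbs-∧ a b ⟨
    a ∨ (a ∧ b)           ≈⟨ ∨-congˡ e ⟩
    a ∨ ⊤                 ≈⟨ ∨-zeroʳ a ⟩
    ⊤                     ∎

  ∧-⊤ʳ : ∀ {a b} → (a ∧ b) ≈ ⊤ → b ≈ ⊤
  ∧-⊤ʳ {a} {b} e = ∧-⊤ˡ (trans (∧-comm b a) e)

  ⇔ᴮ-intro : ∀ {a b} → a ≈ b → ((a ⇒ᴮ b) ∧ (b ⇒ᴮ a)) ≈ ⊤
  ⇔ᴮ-intro e =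
    trans (∧-cong (⇒ᴮ-refl e) (⇒ᴮ-refl (sym e))) (∧-identityʳ ⊤)

  ⇔ᴮ-elim : ∀ {a b} → ((a ⇒ᴮ b) ∧ (b ⇒ᴮ a)) ≈ ⊤ → a ≈ b
  ⇔ᴮ-elim {a} {b} valid = begin
    a                     ≈⟨ ⇒ᴮ-⊤⇒≤ (∧-⊤ˡ valid) ⟨
    a ∧ b                 ≈⟨ ∧-comm a b ⟩
    b ∧ a                 ≈⟨ ⇒ᴮ-⊤⇒≤ (∧-⊤ʳ valid) ⟩
    b                     ∎

  ⇒ᴮ-curry : ∀ a b d → (a ⇒ᴮ (b ⇒ᴮ d)) ≈ ((a ∧ b) ⇒ᴮ d)
  ⇒ᴮ-curry a b d = begin
    ¬ a ∨ (¬ b ∨ d)       ≈⟨ ∨-assoc (¬ a) (¬ b) d ⟨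
    (¬ a ∨ ¬ b) ∨ d       ≈⟨ ∨-congʳ (deMorgan₁ a b) ⟨
    ¬ (a ∧ b) ∨ d         ∎

  ∧-⇒ᴮ-right : ∀ a b → ((a ∧ b) ⇒ᴮ b) ≈ ⊤
  ∧-⇒ᴮ-right a b =
    ≤⇒⇒ᴮ-⊤ (trans (∧-assoc a b b) (∧-congˡ (∧-idem b)))

  ⇒ᴮ-K : ∀ a b → (a ⇒ᴮ (b ⇒ᴮ a)) ≈ ⊤
  ⇒ᴮ-K a b = trans (⇒ᴮ-curry a b a)
                   (trans (⇒ᴮ-congˡ (∧-comm a b)) (∧-⇒ᴮ-right b a))

  ⇒ᴮ-S : ∀ a b d → (a ⇒ᴮ (b ⇒ᴮ d)) ≈ ((a ⇒ᴮ b) ⇒ᴮ (a ⇒ᴮ d))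
  ⇒ᴮ-S a b d = begin
    a ⇒ᴮ (b ⇒ᴮ d)                 ≈⟨ ⇒ᴮ-curry a b d ⟩
    (a ∧ b) ⇒ᴮ d                  ≈⟨ ⇒ᴮ-congˡ guarded ⟨
    ((a ⇒ᴮ b) ∧ a) ⇒ᴮ d           ≈⟨ ⇒ᴮ-curry (a ⇒ᴮ b) a d ⟨
    (a ⇒ᴮ b) ⇒ᴮ (a ⇒ᴮ d)          ∎
    where
    guarded : ((a ⇒ᴮ b) ∧ a) ≈ (a ∧ b)
    guarded = begin
      (¬ a ∨ b) ∧ a               ≈⟨ ∧-comm (¬ a ∨ b) a ⟩
      a ∧ (¬ a ∨ b)               ≈⟨ ∧-distribˡ-∨ a (¬ a) b ⟩
      (a ∧ ¬ a) ∨ (a ∧ b)         ≈⟨ ∨-congʳ (∧-complementʳ a) ⟩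
      ⊥ ∨ (a ∧ b)                 ≈⟨ ∨-identityˡ (a ∧ b) ⟩
      a ∧ b                       ∎

  -- If y agrees with a below x, then a ⇒ (x ⇒ y); this is the Boolean
  -- content of the axiom [X]Y → (X → Y).
  ⇒ᴮ-agree : ∀ {x y a} → (x ∧ a) ≈ (x ∧ y) → (a ⇒ᴮ (x ⇒ᴮ y)) ≈ ⊤
  ⇒ᴮ-agree {x} {y} {a} agree = begin
    a ⇒ᴮ (x ⇒ᴮ y)                 ≈⟨ ⇒ᴮ-curry a x y ⟩
    (a ∧ x) ⇒ᴮ y                  ≈⟨ ⇒ᴮ-congˡ (trans (∧-comm a x) agree) ⟩
    (x ∧ y) ⇒ᴮ y                  ≈⟨ ∧-⇒ᴮ-right x y ⟩
    ⊤                             ∎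

module Components {a q} {A : Set a} (Q : A → Set q) where

  snoc⁻ : ∀ Γ {x} → Any Q (Γ ++ [ x ]) → Any Q Γ ⊎ Q x
  snoc⁻ Γ = Sum.map₂ singleton⁻ ∘ ++⁻ Γ

  extend : ∀ Γ {xs ys} → (Any Q xs → Any Q ys)
         → Any Q (Γ ++ xs) → Any Q (Γ ++ ys)
  extend Γ f = [ ++⁺ˡ , ++⁺ʳ Γ ∘ f ]′ ∘ ++⁻ Γ

  combine : ∀ Γ {x y z} → (Q x → Q y → Q z)
          → Any Q (Γ ++ [ x ]) → Any Q (Γ ++ [ y ]) → Any Q (Γ ++ [ z ])
  combine Γ f p q with snoc⁻ Γ p | snoc⁻ Γ q
  ... | inj₁ γ  | _       = ++⁺ˡ γ
  ... | inj₂ _  | inj₁ γ  = ++⁺ˡ γ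
  ... | inj₂ qx | inj₂ qy = ++⁺ʳ Γ (here (f qx qy))

  cut : ∀ Γ Δ {x y z} → (Q x → Q y → Q z)
      → Any Q (Γ ++ [ x ]) → Any Q (Δ ++ [ y ]) → Any Q (Γ ++ Δ ++ [ z ])
  cut Γ Δ f p q with snoc⁻ Γ p | snoc⁻ Δ q
  ... | inj₁ γ  | _       = ++⁺ˡ γ
  ... | inj₂ _  | inj₁ δ  = ++⁺ʳ Γ (++⁺ˡ δ)
  ... | inj₂ qx | inj₂ qy = ++⁺ʳ Γ (++⁺ʳ Δ (here (f qx qy)))

  contract : ∀ {x} → Any Q (x ∷ x ∷ []) → Any Q [ x ]
  contract (here qx)         = here qx
  contract (there (here qx)) = here qx

module UnderValuation {p} (P : Set p) {c ℓ} (E : BayesianAlgebra c ℓ)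
                      (V : Semantics.Valuation P E) where
  open Syntax P
  open BayesianAlgebra E
  open BooleanAlgebraProperties boolean using (¬-involutive; ¬⊥≈⊤; deMorgan₂; ∨-identityʳ)
  open BooleanImplication boolean
  open Semantics.Valuation V
  open SetoidReasoning setoid

  H-neg : ∀ X → H (¬c X) ≈ ¬ H X
  H-neg X = trans (H-imp X bot) (trans (∨-congˡ H-bot) (∨-identityʳ (¬ H X)))

  H-¬¬ : ∀ X → ¬ H (¬c X) ≈ H X
  H-¬¬ X = trans (¬-cong (H-neg X)) (¬-involutive (H X))

  H-and : ∀ X Y → H (X ∧c Y) ≈ (H X ∧ H Y)
  H-and X Y = begin
    H (X ∧c Y)                     ≈⟨ H-neg (¬c X ∨c ¬c Y) ⟩
    ¬ H (¬c X ∨c ¬c Y)             ≈⟨ ¬-cong (H-imp (¬c (¬c X)) (¬c Y)) ⟩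
    ¬ (¬ H (¬c (¬c X)) ∨ H (¬c Y)) ≈⟨ ¬-cong (∨-cong (H-¬¬ (¬c X)) (H-neg Y)) ⟩
    ¬ (H (¬c X) ∨ ¬ H Y)           ≈⟨ deMorgan₂ (H (¬c X)) (¬ H Y) ⟩
    ¬ H (¬c X) ∧ ¬ ¬ H Y           ≈⟨ ∧-cong (H-¬¬ X) (¬-involutive (H Y)) ⟩
    H X ∧ H Y                      ∎

  H-iff : ∀ X Y → H (X ⇔c Y) ≈ ((H X ⇒ᴮ H Y) ∧ (H Y ⇒ᴮ H X))
  H-iff X Y = trans (H-and (X ⇒ Y) (Y ⇒ X)) (∧-cong (H-imp X Y) (H-imp Y X))

  iff-intro : ∀ X Y → H X ≈ H Y → H (X ⇔c Y) ≈ ⊤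
  iff-intro X Y e = trans (H-iff X Y) (⇔ᴮ-intro e)

  iff-elim : ∀ X Y → H (X ⇔c Y) ≈ ⊤ → H X ≈ H Y
  iff-elim X Y valid = ⇔ᴮ-elim (trans (sym (H-iff X Y)) valid)

  imp-intro : ∀ X Y → H X ≈ H Y → H (X ⇒ Y) ≈ ⊤
  imp-intro X Y e = trans (H-imp X Y) (⇒ᴮ-refl e)

  true-K : ∀ X Y → H (X ⇒ (Y ⇒ X)) ≈ ⊤
  true-K X Y =
    trans (trans (H-imp X (Y ⇒ X)) (∨-congˡ (H-imp Y X))) (⇒ᴮ-K (H X) (H Y))

  true-S : ∀ X Y Z → H ((X ⇒ (Y ⇒ Z)) ⇒ ((X ⇒ Y) ⇒ (X ⇒ Z))) ≈ ⊤
  true-S X Y Z = imp-intro _ _ (begin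
    H (X ⇒ (Y ⇒ Z))                  ≈⟨ trans (H-imp X _) (∨-congˡ (H-imp Y Z)) ⟩
    H X ⇒ᴮ (H Y ⇒ᴮ H Z)              ≈⟨ ⇒ᴮ-S (H X) (H Y) (H Z) ⟩
    (H X ⇒ᴮ H Y) ⇒ᴮ (H X ⇒ᴮ H Z)     ≈⟨ ∨-cong (¬-cong (H-imp X Y)) (H-imp X Z) ⟨
    H (X ⇒ Y) ⇒ᴮ H (X ⇒ Z)           ≈⟨ H-imp (X ⇒ Y) (X ⇒ Z) ⟨
    H ((X ⇒ Y) ⇒ (X ⇒ Z))            ∎)

  true-DNE : ∀ X → H (¬c (¬c X) ⇒ X) ≈ ⊤
  true-DNE X = imp-intro _ _ (trans (H-neg (¬c X)) (H-¬¬ X))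

  true-Dist : ∀ X Y Z → H (⟦ X ⟧ (Y ⇒ Z) ⇒ (⟦ X ⟧ Y ⇒ ⟦ X ⟧ Z)) ≈ ⊤
  true-Dist X Y Z = imp-intro _ _ (begin
    H (⟦ X ⟧ (Y ⇒ Z))                     ≈⟨ H-cnd X (Y ⇒ Z) ⟩
    cnd (H X) (H (Y ⇒ Z))                 ≈⟨ cnd-cong refl (H-imp Y Z) ⟩
    cnd (H X) (¬ H Y ∨ H Z)               ≈⟨ hom-∨ (H X) (¬ H Y) (H Z) ⟩
    cnd (H X) (¬ H Y) ∨ cnd (H X) (H Z)   ≈⟨ ∨-congʳ (hom-¬ (H X) (H Y)) ⟩
    ¬ cnd (H X) (H Y) ∨ cnd (H X) (H Z)   ≈⟨ ∨-cong (¬-cong (H-cnd X Y)) (H-cnd X Z) ⟨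
    ¬ H (⟦ X ⟧ Y) ∨ H (⟦ X ⟧ Z)           ≈⟨ H-imp (⟦ X ⟧ Y) (⟦ X ⟧ Z) ⟨
    H (⟦ X ⟧ Y ⇒ ⟦ X ⟧ Z)                 ∎)

  true-MP : ∀ X Y → H (⟦ X ⟧ Y ⇒ (X ⇒ Y)) ≈ ⊤
  true-MP X Y = begin
    H (⟦ X ⟧ Y ⇒ (X ⇒ Y))             ≈⟨ H-imp (⟦ X ⟧ Y) (X ⇒ Y) ⟩
    ¬ H (⟦ X ⟧ Y) ∨ H (X ⇒ Y)         ≈⟨ ∨-cong (¬-cong (H-cnd X Y)) (H-imp X Y) ⟩
    cnd (H X) (H Y) ⇒ᴮ (H X ⇒ᴮ H Y)   ≈⟨ ⇒ᴮ-agree (meet (H X) (H Y)) ⟩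
    ⊤                                 ∎

  true-Neg : ∀ X Y → H ((⟦ X ⟧ (¬c Y)) ⇔c (¬c (⟦ X ⟧ Y))) ≈ ⊤
  true-Neg X Y = iff-intro _ _ (begin
    H (⟦ X ⟧ (¬c Y))         ≈⟨ H-cnd X (¬c Y) ⟩
    cnd (H X) (H (¬c Y))     ≈⟨ cnd-cong refl (H-neg Y) ⟩
    cnd (H X) (¬ H Y)        ≈⟨ hom-¬ (H X) (H Y) ⟩
    ¬ cnd (H X) (H Y)        ≈⟨ ¬-cong (H-cnd X Y) ⟨
    ¬ H (⟦ X ⟧ Y)            ≈⟨ H-neg (⟦ X ⟧ Y) ⟨
    H (¬c (⟦ X ⟧ Y))         ∎)

  preserves-mp : ∀ X Y → H X ≈ ⊤ → H (X ⇒ Y) ≈ ⊤ → H Y ≈ ⊤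
  preserves-mp X Y x≈⊤ valid = ⇒ᴮ-mp x≈⊤ (trans (sym (H-imp X Y)) valid)

  -- If X → Y is true then H X ⊂ H Y, so by the subset law either H X = ⊥
  -- (and ¬X is true) or [X]Y is true.
  preserves-cond : ∀ X Y → H (X ⇒ Y) ≈ ⊤ → (H (¬c X) ≈ ⊤) ⊎ (H (⟦ X ⟧ Y) ≈ ⊤)
  preserves-cond X Y valid
    with subset (H X) (H Y) (⇒ᴮ-⊤⇒≤ (trans (sym (H-imp X Y)) valid))
  ... | inj₁ cnd≈⊤ = inj₂ (trans (H-cnd X Y) cnd≈⊤)
  ... | inj₂ x≈⊥   = inj₁ (trans (H-neg X) (trans (¬-cong x≈⊥) ¬⊥≈⊤))

  -- If Y means ¬X and Z is independent of X, then Z is independent of Y,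
  -- because [∼x][x]z = [x]z.
  preserves-indep : ∀ X Y Z → H (Y ⇔c ¬c X) ≈ ⊤ → H ((⟦ X ⟧ Z) ⇔c Z) ≈ ⊤
                  → H ((⟦ Y ⟧ Z) ⇔c Z) ≈ ⊤
  preserves-indep X Y Z y≈¬x independent = iff-intro _ _ (begin
    H (⟦ Y ⟧ Z)                       ≈⟨ H-cnd Y Z ⟩
    cnd (H Y) (H Z)                   ≈⟨ cnd-cong (trans (iff-elim _ _ y≈¬x) (H-neg X)) (sym xz≈z) ⟩
    cnd (¬ H X) (cnd (H X) (H Z))     ≈⟨ idem-¬ (H X) (H Z) ⟩
    cnd (H X) (H Z)                   ≈⟨ xz≈z ⟩
    H Z                               ∎)
    where
    xz≈z : cnd (H X) (H Z) ≈ H Z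
    xz≈z = trans (sym (H-cnd X Z)) (iff-elim _ _ independent)

module _ {p} (P : Set p) {c ℓ} (E : BayesianAlgebra c ℓ)
         (V : Semantics.Valuation P E) where
  open Syntax P
  open BayesianAlgebra E using (_≈_; ⊤)
  open Semantics P E using (_⊨_)
  open Semantics.Valuation V using (H)
  open UnderValuation P E V
  open Components (λ X → H X ≈ ⊤)

  conditioning : ∀ X Y → V ⊨ [ X ⇒ Y ] → V ⊨ (¬c X ∷ ⟦ X ⟧ Y ∷ [])
  conditioning X Y = [ here , there ∘ here ]′ ∘ preserves-cond X Y ∘ singleton⁻

  sound : ∀ {Γ} → ⊢ Γ → V ⊨ Γ
  sound (axK X Y)             = here (true-K X Y)
  sound (axS X Y Z)           = here (true-S X Y Z)
  sound (axDNE X)             = here (true-DNE X)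
  sound (axDist X Y Z)        = here (true-Dist X Y Z)
  sound (axMP X Y)            = here (true-MP X Y)
  sound (axNeg X Y)           = here (true-Neg X Y)
  sound (mp Γ Δ X Y d e)      = cut Γ Δ (preserves-mp X Y) (sound d) (sound e)
  sound (perm Γ Δ π d)        = Any-resp-↭ π (sound d)
  sound (contr Γ X d)         = extend Γ contract (sound d)
  sound (weak Γ X d)          = ++⁺ˡ (sound d)
  sound (cond Γ X Y d)        = extend Γ (conditioning X Y) (sound d)
  sound (indep Γ X Y Z d e)   = combine Γ (preserves-indep X Y Z) (sound d) (sound e)

mainTheorem7 : ∀ {p} (P : Set p) (Γ : List (Syntax.Cond P))
    → Syntax.⊢_ P Γ
    → ∀ {c ℓ} (E : BayesianAlgebra c ℓ) → Semantics.ValidIn P E Γ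
mainTheorem7 P Γ d E V = sound P E V d
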